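{- Any class $\mathcal{G}$ of graphs of bounded shrubdepth admits a constant-size equality-based adjacency labelling scheme.
   Context: A connection model for a graph $G$ is a rooted tree $T$ whose nodes are coloured with colours from some set $[k]$, such that the vertices of $G$ are exactly the leaves of $T$, and for any two vertices $u,v$ of $G$, whether $u,v$ are adjacent depends only on the colours of $u$, of $v$, and of the lowest common ancestor of $u,v$ in $T$. A class $\mathcal{G}$ has bounded shrubdepth if there are $d,k\in\mathbb{N}$ such that every $G\in\mathcal{G}$ has a connection model of depth at most $d$ (maximum number of edges on a root-to-leaf path) using colours in $[k]$. An $(s,k)$-equality-based adjacency labelling scheme for $\mathcal{G}$ assigns deterministically to each vertex $x$ of each $G\in\mathcal{G}$ (vertex set $[n]$) a label $(p(x)\mid q(x))$ with $p(x)\in\{0,1\}^s$ and $q(x)\in\mathbb{N}^k$, and has a decoder which, on the labels of $x,y$, chooses a function $D_{p(x),p(y)}:\{0,1\}^{k\times k}\to\{0,1\}$ depending only on $p(x),p(y)$ and outputs $D_{p(x),p(y)}(Q_{x,y})$, where $Q_{x,y}(i,j)=1$ iff $q(x)_i=q(y)_j$; the output must equal $1$ iff $x,y$ are adjacent in $G$. Constant-size means $s$ and $k$ are constants independent of $G$. -}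

module Defs where

open import Data.Nat using (ℕ; zero; suc; _≟_)
open import Data.Bool using (Bool)
open import Data.Fin using (Fin)
open import Data.List using (List; []; _∷_; _++_; map; allFin)
open import Data.List.Relation.Unary.All using (All)
open import Data.List.Relation.Unary.Any using (Any)
open import Data.List.Membership.Propositional using (_∈_)
open import Data.List.Relation.Binary.Permutation.Propositional using (_↭_)
open import Data.Vec using (Vec; lookup; tabulate)
open import Data.Product using (Σ; ∃; ∃-syntax; _×_; _,_; proj₁)
open import Relation.Binary.PropositionalEquality using (_≡_; _≢_)
open import Relation.Nullary.Decidable using (⌊_⌋)

record Graph : Set where
  field
    n     : ℕ
    adj   : Fin n → Fin n → Bool
    sym   : ∀ u v → adj u v ≡ adj v u
    irrefl : ∀ u → adj u u ≡ Bool.false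

open Graph public

GraphClass : Set₁
GraphClass = Graph → Set

-- Internal nodes have a non-empty list of
-- children (t ∷ ts), so the leaves of the tree are exactly the `leaf` nodes.

data CTree (k n : ℕ) : Set where
  leaf : (c : Fin k) → (v : Fin n) → CTree k n
  node : (c : Fin k) → (t : CTree k n) → (ts : List (CTree k n)) → CTree k n

module _ {k n : ℕ} where

  mutual
    leaves : CTree k n → List (Fin n × Fin k)
    leaves (leaf c v) = (v , c) ∷ []
    leaves (node c t ts) = leaves t ++ leavesL ts

    leavesL : List (CTree k n) → List (Fin n × Fin k)
    leavesL [] = []
    leavesL (t ∷ ts) = leaves t ++ leavesL ts

  verts : CTree k n → List (Fin n)
  verts T = map proj₁ (leaves T)

  data Depth≤ : ℕ → CTree k n → Set where
    leaf≤ : ∀ {d c v} → Depth≤ d (leaf c v)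
    node≤ : ∀ {d c t ts} → Depth≤ d t → All (Depth≤ d) ts →
            Depth≤ (suc d) (node c t ts)

  -- LCA T u v c : the lowest common ancestor of leaves u and v in T has colour c
  data LCA : CTree k n → Fin n → Fin n → Fin k → Set where
    here  : ∀ {c t ts u v} (i j : Fin (Data.List.length (t ∷ ts))) → i ≢ j →
            u ∈ verts (Data.List.lookup (t ∷ ts) i) →
            v ∈ verts (Data.List.lookup (t ∷ ts) j) →
            LCA (node c t ts) u v c
    there : ∀ {c c' t ts u v} → Any (λ s → LCA s u v c') (t ∷ ts) →
            LCA (node c t ts) u v c'

record ConnectionModel (d k : ℕ) (G : Graph) : Set where
  field
    tree      : CTree k (n G)
    rule      : Fin k → Fin k → Fin k → Bool
    depth≤    : Depth≤ d tree
    -- the leaves of the tree are exactly the vertices of G (each once)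
    leavesAreVertices : verts tree ↭ allFin (n G)
    adjacency : ∀ (u v : Fin (n G)) (cu cv c : Fin k) → u ≢ v →
                (u , cu) ∈ leaves tree → (v , cv) ∈ leaves tree →
                LCA tree u v c → adj G u v ≡ rule cu cv c

BoundedShrubdepth : GraphClass → Set
BoundedShrubdepth 𝒢 = ∃[ d ] ∃[ k ] (∀ G → 𝒢 G → ConnectionModel d k G)

eqMatrix : ∀ {k} → Vec ℕ k → Vec ℕ k → Vec (Vec Bool k) k
eqMatrix qx qy = tabulate λ i → tabulate λ j → ⌊ lookup qx i ≟ lookup qy j ⌋

record EqLabellingScheme (s k : ℕ) (𝒢 : GraphClass) : Set where
  field
    p : (G : Graph) → 𝒢 G → Fin (n G) → Vec Bool s
    q : (G : Graph) → 𝒢 G → Fin (n G) → Vec ℕ k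
    D : Vec Bool s → Vec Bool s → Vec (Vec Bool k) k → Bool
    correct : ∀ (G : Graph) (g : 𝒢 G) (x y : Fin (n G)) →
              D (p G g x) (p G g y) (eqMatrix (q G g x) (q G g y)) ≡ adj G x y

ConstantSizeEqLabelling : GraphClass → Set
ConstantSizeEqLabelling 𝒢 = ∃[ s ] ∃[ k ] EqLabellingScheme s k 𝒢

{-# OPTIONS --safe #-}
module Submission where

-- Label a vertex x by the child indices along the root-to-x path of a connection model of
-- depth d, preceded by x itself (the equality part), and by its colour together with, for each
-- depth j, the row c ↦ rule (colour x) c (colour of the j-th node of the path) (the bit part).
-- For x ≠ y, the diagonal of the equality matrix locates the first depth at which the two paths
-- branch, i.e. the depth of the lowest common ancestor; the row of x at that depth, evaluated at
-- the colour of y, is the adjacency bit. Both parts have size depending on d and k only.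

open import Defs hiding (sym)
open import Data.Nat using (ℕ; zero; suc; _+_; _*_)
import Data.Nat as ℕ
open import Data.Bool using (Bool; true; false; _∧_; _∨_)
open import Data.Bool.Properties using (∨-identityʳ)
open import Data.Fin using (Fin; zero; suc; toℕ; _↑ˡ_; _↑ʳ_; combine)
open import Data.Fin.Properties using (toℕ-injective)
open import Data.List using (List; []; _∷_; length)
import Data.List as List
import Data.List.Relation.Unary.All as All
open import Data.List.Relation.Unary.Any using (here; there)
open import Data.List.Membership.Propositional using (_∈_; lose)
open import Data.List.Membership.Propositional.Properties
  using (∈-++⁺ˡ; ∈-++⁺ʳ; ∈-++⁻; ∈-map⁺; ∈-map⁻; ∈-allFin; ∈-lookup)
open import Data.List.Relation.Binary.Permutation.Propositional using (↭-sym)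
open import Data.List.Relation.Binary.Permutation.Propositional.Properties using (∈-resp-↭)
open import Data.Vec using (Vec; []; _∷_; _++_; replicate; lookup; tabulate; concat; diagonal; map; tail)
open import Data.Vec.Properties
  using (tabulate-cong; tabulate-∘; tabulate∘lookup; lookup∘tabulate; lookup-map; lookup-++ˡ; lookup-++ʳ; lookup-concat)
open import Data.Maybe using (Maybe; just; nothing; maybe′)
import Data.Maybe as Maybe
open import Data.Product using (∃; ∃₂; _×_; _,_; proj₁; proj₂)
open import Data.Sum using (inj₁; inj₂)
open import Data.Empty using (⊥-elim)
open import Function using (_∘_)
open import Relation.Nullary using (yes; no)
open import Relation.Nullary.Decidable using (⌊_⌋)
open import Relation.Binary.PropositionalEquality using (_≡_; _≢_; refl; sym; trans; cong; cong₂; module ≡-Reasoning)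

firstFalse : ∀ {m} → Vec Bool m → Maybe (Fin m)
firstFalse []           = nothing
firstFalse (true ∷ bs)  = Maybe.map suc (firstFalse bs)
firstFalse (false ∷ bs) = just zero

oneHot : ∀ {m} → Fin m → Vec Bool m
oneHot zero    = true ∷ replicate _ false
oneHot (suc i) = false ∷ oneHot i

infix 7 _·_
_·_ : ∀ {m} → Vec Bool m → Vec Bool m → Bool
[]       · []       = false
(a ∷ as) · (b ∷ bs) = (a ∧ b) ∨ (as · bs)

replicate-false-· : ∀ {m} (bs : Vec Bool m) → replicate m false · bs ≡ false
replicate-false-· []       = refl
replicate-false-· (b ∷ bs) = replicate-false-· bs

oneHot-· : ∀ {m} (i : Fin m) (bs : Vec Bool m) → oneHot i · bs ≡ lookup bs i
oneHot-· zero    (b ∷ bs) rewrite replicate-false-· bs = ∨-identityʳ b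
oneHot-· (suc i) (b ∷ bs) = oneHot-· i bs

diagonal-tabulate : ∀ {a} {A : Set a} {m} (f : Fin m → Fin m → A) →
                    diagonal (tabulate λ i → tabulate (f i)) ≡ tabulate λ i → f i i
diagonal-tabulate {m = zero}  f = refl
diagonal-tabulate {m = suc m} f =
  cong (f zero zero ∷_) (begin
    diagonal (map tail (tabulate λ i → tabulate (f (suc i))))
      ≡⟨ cong diagonal (sym (tabulate-∘ tail (λ i → tabulate (f (suc i))))) ⟩
    diagonal (tabulate λ i → tabulate (f (suc i) ∘ suc))
      ≡⟨ diagonal-tabulate (λ i j → f (suc i) (suc j)) ⟩
    tabulate (λ i → f (suc i) (suc i)) ∎)
  where open ≡-Reasoning

agreement : ∀ {m} → Vec ℕ m → Vec ℕ m → Vec Bool m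
agreement as bs = tabulate λ i → ⌊ lookup as i ℕ.≟ lookup bs i ⌋

diagonal-eqMatrix : ∀ {m} (as bs : Vec ℕ m) → diagonal (eqMatrix as bs) ≡ agreement as bs
diagonal-eqMatrix as bs = diagonal-tabulate λ i j → ⌊ lookup as i ℕ.≟ lookup bs j ⌋

module _ {k n : ℕ} where

  ∈-leavesL⁺ : ∀ {x} (ts : List (CTree k n)) i → x ∈ leaves (List.lookup ts i) → x ∈ leavesL ts
  ∈-leavesL⁺ (t ∷ ts) zero    x∈t = ∈-++⁺ˡ x∈t
  ∈-leavesL⁺ (t ∷ ts) (suc i) x∈t = ∈-++⁺ʳ (leaves t) (∈-leavesL⁺ ts i x∈t)

  ∈-leavesL⁻ : ∀ {x} (ts : List (CTree k n)) → x ∈ leavesL ts → ∃ λ i → x ∈ leaves (List.lookup ts i)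
  ∈-leavesL⁻ (t ∷ ts) x∈ts with ∈-++⁻ (leaves t) x∈ts
  ... | inj₁ x∈t  = zero , x∈t
  ... | inj₂ x∈ts′ with ∈-leavesL⁻ ts x∈ts′
  ...   | i , x∈tᵢ = suc i , x∈tᵢ

  -- Below the leaf, the entries of both vectors are arbitrary padding.
  data PathTo : (d : ℕ) → CTree k n → Fin n → Fin k → Vec ℕ d → Vec (Fin k) d → Set where
    leaf : ∀ {d c v is cs} → PathTo d (leaf c v) v c is cs
    node : ∀ {d c t ts v cv is cs} (i : Fin (length (t ∷ ts))) →
           PathTo d (List.lookup (t ∷ ts) i) v cv is cs →
           PathTo (suc d) (node c t ts) v cv (toℕ i ∷ is) (c ∷ cs)

  ∈leaves⇒pathTo : ∀ {d T v c} → Depth≤ d T → (v , c) ∈ leaves T → ∃₂ λ is cs → PathTo d T v c is cs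
  ∈leaves⇒pathTo {d} {c = c} leaf≤ (here refl) = replicate d 0 , replicate d c , leaf
  ∈leaves⇒pathTo {T = node _ t ts} (node≤ t≤ ts≤) v∈T with ∈-leavesL⁻ (t ∷ ts) v∈T
  ... | i , v∈tᵢ with ∈leaves⇒pathTo (All.lookup (t≤ All.∷ ts≤) (∈-lookup i)) v∈tᵢ
  ...   | is , cs , p = toℕ i ∷ is , _ ∷ cs , node i p

  pathTo⇒∈leaves : ∀ {d T v c is cs} → PathTo d T v c is cs → (v , c) ∈ leaves T
  pathTo⇒∈leaves leaf                    = here refl
  pathTo⇒∈leaves (node {t = t} {ts} i p) = ∈-leavesL⁺ (t ∷ ts) i (pathTo⇒∈leaves p)

  pathTo⇒∈verts : ∀ {d T v c is cs} → PathTo d T v c is cs → v ∈ verts T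
  pathTo⇒∈verts = ∈-map⁺ proj₁ ∘ pathTo⇒∈leaves

  pathTo-lca : ∀ {d T u v cu cv is js cs cs′} → PathTo d T u cu is cs → PathTo d T v cv js cs′ → u ≢ v →
               ∃ λ j → firstFalse (agreement is js) ≡ just j × LCA T u v (lookup cs j)
  pathTo-lca leaf leaf u≢v = ⊥-elim (u≢v refl)
  pathTo-lca (node i p) (node i′ p′) u≢v with toℕ i ℕ.≟ toℕ i′
  ... | no  i≢i′ = zero , refl , here i i′ (i≢i′ ∘ cong toℕ) (pathTo⇒∈verts p) (pathTo⇒∈verts p′)
  ... | yes i≡i′ with refl ← toℕ-injective i≡i′ with j , first≡j , lca ← pathTo-lca p p′ u≢v =
    suc j , cong (Maybe.map suc) first≡j , there (lose (∈-lookup i) lca)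

module _ {k d : ℕ} where

  colourBits : Vec Bool (k + d * k) → Vec Bool k
  colourBits bs = tabulate λ c → lookup bs (c ↑ˡ d * k)

  rowBits : Vec Bool (k + d * k) → Fin d → Vec Bool k
  rowBits bs j = tabulate λ c → lookup bs (k ↑ʳ combine j c)

  colourBits-++ : (xs : Vec Bool k) (rows : Vec (Vec Bool k) d) → colourBits (xs ++ concat rows) ≡ xs
  colourBits-++ xs rows = trans (tabulate-cong (lookup-++ˡ xs (concat rows))) (tabulate∘lookup xs)

  rowBits-++ : (xs : Vec Bool k) (rows : Vec (Vec Bool k) d) (j : Fin d) →
               rowBits (xs ++ concat rows) j ≡ lookup rows j
  rowBits-++ xs rows j =
    trans (tabulate-cong λ c → trans (lookup-++ʳ xs (concat rows) (combine j c)) (lookup-concat rows j c))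
          (tabulate∘lookup (lookup rows j))

  readAdjacency : Vec Bool (k + d * k) → Vec Bool (k + d * k) → Vec Bool (suc d) → Bool
  readAdjacency px py (true  ∷ _)     = false
  readAdjacency px py (false ∷ agree) = maybe′ (λ j → colourBits py · rowBits px j) false (firstFalse agree)

  decode : Vec Bool (k + d * k) → Vec Bool (k + d * k) → Vec (Vec Bool (suc d)) (suc d) → Bool
  decode px py Q = readAdjacency px py (diagonal Q)

module Labelling {d k : ℕ} (G : Graph) (M : ConnectionModel d k G) where
  open ConnectionModel M

  leafOf : ∀ x → ∃ λ c → (x , c) ∈ leaves tree
  leafOf x with ∈-map⁻ proj₁ (∈-resp-↭ (↭-sym leavesAreVertices) (∈-allFin x))
  ... | (_ , c) , x∈tree , refl = c , x∈tree

  colour : Fin (n G) → Fin k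
  colour = proj₁ ∘ leafOf

  path : ∀ x → ∃₂ λ is cs → PathTo d tree x (colour x) is cs
  path x = ∈leaves⇒pathTo depth≤ (proj₂ (leafOf x))

  childIndices : Fin (n G) → Vec ℕ d
  childIndices = proj₁ ∘ path

  ancestorColours : Fin (n G) → Vec (Fin k) d
  ancestorColours = proj₁ ∘ proj₂ ∘ path

  ruleRow : Fin k → Fin k → Vec Bool k
  ruleRow cx c = tabulate λ cy → rule cx cy c

  rows : Fin (n G) → Vec (Vec Bool k) d
  rows x = map (ruleRow (colour x)) (ancestorColours x)

  p : Fin (n G) → Vec Bool (k + d * k)
  p x = oneHot (colour x) ++ concat (rows x)

  q : Fin (n G) → Vec ℕ (suc d)
  q x = toℕ x ∷ childIndices x

  readAdjacency-correct : ∀ x y → readAdjacency (p x) (p y) (agreement (q x) (q y)) ≡ adj G x y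
  readAdjacency-correct x y with toℕ x ℕ.≟ toℕ y
  ... | yes x≡y with refl ← toℕ-injective x≡y = sym (irrefl G x)
  ... | no  x≢y with pathTo-lca (proj₂ (proj₂ (path x))) (proj₂ (proj₂ (path y))) (x≢y ∘ cong toℕ)
  ...   | j , first≡j , lca = begin
    maybe′ bit false (firstFalse (agreement (childIndices x) (childIndices y)))
      ≡⟨ cong (maybe′ bit false) first≡j ⟩
    colourBits {d = d} (p y) · rowBits (p x) j
      ≡⟨ cong₂ _·_ (colourBits-++ (oneHot (colour y)) (rows y)) (rowBits-++ (oneHot (colour x)) (rows x) j) ⟩
    oneHot (colour y) · lookup (rows x) j
      ≡⟨ cong (oneHot (colour y) ·_) (lookup-map j (ruleRow (colour x)) (ancestorColours x)) ⟩
    oneHot (colour y) · ruleRow (colour x) (lookup (ancestorColours x) j)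
      ≡⟨ oneHot-· (colour y) _ ⟩
    lookup (ruleRow (colour x) (lookup (ancestorColours x) j)) (colour y)
      ≡⟨ lookup∘tabulate _ (colour y) ⟩
    rule (colour x) (colour y) (lookup (ancestorColours x) j)
      ≡⟨ sym (adjacency x y _ _ _ (x≢y ∘ cong toℕ) (proj₂ (leafOf x)) (proj₂ (leafOf y)) lca) ⟩
    adj G x y ∎
    where
    open ≡-Reasoning
    bit : Fin d → Bool
    bit i = colourBits {d = d} (p y) · rowBits (p x) i

  decode-correct : ∀ x y → decode (p x) (p y) (eqMatrix (q x) (q y)) ≡ adj G x y
  decode-correct x y =
    trans (cong (readAdjacency (p x) (p y)) (diagonal-eqMatrix (q x) (q y))) (readAdjacency-correct x y)

lemma4p8 : (𝒢 : GraphClass) → BoundedShrubdepth 𝒢 → ConstantSizeEqLabelling 𝒢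
lemma4p8 𝒢 (d , k , model) = k + d * k , suc d , record
  { p       = λ G g → Labelling.p G (model G g)
  ; q       = λ G g → Labelling.q G (model G g)
  ; D       = decode
  ; correct = λ G g → Labelling.decode-correct G (model G g)
  }
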